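{- Let $r > 2$ be an integer and let $T_r$ be the triangular grid graph of dimension $r$. Then $OD(T_r) = r+1$.
   Context: The triangular grid graph $T_r$ of dimension $r$ has as vertex set all ordered triples $(i,j,k)$ of nonnegative integers with $i+j+k=r$; two vertices $(i,j,k)$ and $(i',j',k')$ are adjacent if and only if $|i-i'|+|j-j'|+|k-k'| = 2$. An orientation of an undirected graph assigns a direction to each edge; it is strongly connected if every vertex can reach every other vertex by a directed path. The diameter of a directed graph is the maximum, over all ordered pairs of vertices, of the shortest directed path distance, measured in number of edges. The oriented diameter $OD(G)$ of an undirected graph $G$ is the minimum diameter over all strongly connected orientations of $G$. -}

module Defs where

open import Data.Nat using (ℕ; zero; suc; _+_; _≤_; ∣_-_∣)
open import Data.Bool using (Bool; true; not)
open import Data.Product using (Σ; ∃; _×_; _,_)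
open import Relation.Binary.PropositionalEquality using (_≡_)

Triple : Set
Triple = ℕ × ℕ × ℕ

Vertex : ℕ → Set
Vertex r = Σ Triple (λ { (i , j , k) → i + j + k ≡ r })

Adj : (r : ℕ) → Vertex r → Vertex r → Set
Adj r ((i , j , k) , _) ((i' , j' , k') , _) = ∣ i - i' ∣ + ∣ j - j' ∣ + ∣ k - k' ∣ ≡ 2

-- An orientation of T_r: a function dir such that for every edge {u,v}
-- exactly one of dir u v, dir v u is true (values on non-edges are irrelevant).
record Orientation (r : ℕ) : Set where
  field
    dir        : Vertex r → Vertex r → Bool
    antisym    : ∀ u v → Adj r u v → dir u v ≡ not (dir v u)

open Orientation public

Arc : {r : ℕ} → Orientation r → Vertex r → Vertex r → Set
Arc {r} o u v = Adj r u v × dir o u v ≡ true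

data Walk {r : ℕ} (o : Orientation r) : ℕ → Vertex r → Vertex r → Set where
  here : ∀ {u} → Walk o 0 u u
  step : ∀ {n u v w} → Arc o u v → Walk o n v w → Walk o (suc n) u w

ReachWithin : {r : ℕ} → Orientation r → ℕ → Vertex r → Vertex r → Set
ReachWithin o d u v = ∃ λ n → n ≤ d × Walk o n u v

StronglyConnected : {r : ℕ} → Orientation r → Set
StronglyConnected o = ∀ u v → ∃ λ d → ReachWithin o d u v

DiameterAtMost : {r : ℕ} → Orientation r → ℕ → Set
DiameterAtMost o d = ∀ u v → ReachWithin o d u v

OrientedDiameterIs : ℕ → ℕ → Set
OrientedDiameterIs r d =
  (Σ (Orientation r) λ o → StronglyConnected o × DiameterAtMost o d)
  × (∀ (o : Orientation r) → StronglyConnected o → ∀ d' → DiameterAtMost o d' → d ≤ d')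

-- Lower bound: the corner (r , 0 , 0) has only the neighbours (r - 1 , 1 , 0) and
-- (r - 1 , 0 , 1). Some arc enters the corner, say from (r - 1 , 0 , 1), as otherwise nothing
-- reaches it. Then every walk from the corner starts with a step that does not raise the
-- third coordinate, and since no step raises it by more than one, reaching (0 , 0 , r)
-- takes r + 1 steps.
--
-- Upper bound: on an even level direct every line of the grid uniformly, alternating between
-- parallel lines. Rows k ≥ 2 form a copy of level r - 2, and two vertices of the bottom rows
-- are joined by following whichever of rows 0 and 1 runs the right way, entering and leaving
-- it with few detours. Induction on r in steps of two, from level 4, gives diameter r + 1,
-- once it also carries bounds on the distances from the corners, which the paths between
-- the two parts use. On an odd level, place the even orientation of level r - 1 on rows
-- k ≥ 1 and run row 0 towards j. Levels 3 and 4 are checked by exhaustive search.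
module Submission where

open import Defs
open import Data.Nat using (ℕ; zero; suc; _+_; _∸_; _≤_; _<_; z≤n; s≤s; ∣_-_∣; _≟_; _≤?_; _≡ᵇ_)
open import Data.Nat.Properties
open import Data.Nat.Tactic.RingSolver using (solve-∀)
open import Data.Bool using (Bool; true; false; not; _xor_; if_then_else_)
open import Data.Bool.Properties using (not-involutive; not-distribˡ-xor)
open import Data.Product using (Σ; ∃; _×_; _,_; proj₁; proj₂)
open import Data.Product.Properties using (≡-dec)
open import Data.Sum using (_⊎_; inj₁; inj₂)
open import Data.List using (List; []; _∷_; _++_; map; foldr; mapMaybe)
open import Data.List.Membership.Propositional using (_∈_)
open import Data.List.Membership.Propositional.Properties using (∈-map⁺; ∈-++⁺ˡ; ∈-++⁺ʳ)
open import Data.List.Relation.Unary.Any using (here; there)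
open import Data.List.Relation.Unary.All as All using (All)
open import Data.Maybe using (Maybe; just; nothing; from-just; _<∣>_)
import Data.Maybe as Maybe
open import Data.Maybe.Effectful using (applicative)
open import Data.Empty using (⊥-elim)
open import Function using (_∘_)
open import Relation.Binary.PropositionalEquality
open import Relation.Nullary using (yes; no; Dec)

total : Triple → ℕ
total (i , j , k) = i + j + k

_≟ᵗ_ : (a b : Triple) → Dec (a ≡ b)
_≟ᵗ_ = ≡-dec _≟_ (≡-dec _≟_ _≟_)

odd : ℕ → Bool
odd zero          = false
odd (suc zero)    = true
odd (suc (suc n)) = odd n

odd-suc : ∀ n → odd (suc n) ≡ not (odd n)
odd-suc zero          = refl
odd-suc (suc zero)    = refl
odd-suc (suc (suc n)) = odd-suc n

odd-+ : ∀ m n → odd (m + n) ≡ odd m xor odd n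
odd-+ zero    n = refl
odd-+ (suc m) n = begin
  odd (suc (m + n))       ≡⟨ odd-suc (m + n) ⟩
  not (odd (m + n))       ≡⟨ cong not (odd-+ m n) ⟩
  not (odd m xor odd n)   ≡⟨ not-distribˡ-xor (odd m) (odd n) ⟩
  not (odd m) xor odd n   ≡⟨ cong (_xor odd n) (odd-suc m) ⟨
  odd (suc m) xor odd n   ∎
  where open ≡-Reasoning

not-odd-suc : ∀ n → not (odd (suc n)) ≡ odd n
not-odd-suc n = trans (cong not (odd-suc n)) (not-involutive (odd n))

i+0+0≡i : ∀ i → i + 0 + 0 ≡ i
i+0+0≡i i = trans (+-identityʳ (i + 0)) (+-identityʳ i)

coord≤total : ∀ {i j k n} → i + j + k ≡ n → i ≤ n
coord≤total {i} {j} {k} s = ≤-trans (m≤m+n i (j + k)) (≤-reflexive (trans (sym (+-assoc i j k)) s))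

data Move : Triple → Triple → Set where
  i↝j : ∀ {i j k} → Move (suc i , j , k) (i , suc j , k)
  j↝i : ∀ {i j k} → Move (i , suc j , k) (suc i , j , k)
  j↝k : ∀ {i j k} → Move (i , suc j , k) (i , j , suc k)
  k↝j : ∀ {i j k} → Move (i , j , suc k) (i , suc j , k)
  k↝i : ∀ {i j k} → Move (i , j , suc k) (suc i , j , k)
  i↝k : ∀ {i j k} → Move (suc i , j , k) (i , j , suc k)

∣m-n∣≡1⇒ : ∀ {m n} → ∣ m - n ∣ ≡ 1 → m ≡ suc n ⊎ n ≡ suc m
∣m-n∣≡1⇒ {zero}  {suc zero} _ = inj₂ refl
∣m-n∣≡1⇒ {suc zero} {zero}  _ = inj₁ refl
∣m-n∣≡1⇒ {suc m} {suc n}    e with ∣m-n∣≡1⇒ {m} {n} e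
... | inj₁ m≡1+n = inj₁ (cong suc m≡1+n)
... | inj₂ n≡1+m = inj₂ (cong suc n≡1+m)

∣m-n∣≡2⇒ : ∀ {m n} → ∣ m - n ∣ ≡ 2 → m ≡ 2 + n ⊎ n ≡ 2 + m
∣m-n∣≡2⇒ {zero} {suc (suc zero)} _ = inj₂ refl
∣m-n∣≡2⇒ {suc (suc zero)} {zero} _ = inj₁ refl
∣m-n∣≡2⇒ {suc m} {suc n}         e with ∣m-n∣≡2⇒ {m} {n} e
... | inj₁ m≡2+n = inj₁ (cong suc m≡2+n)
... | inj₂ n≡2+m = inj₂ (cong suc n≡2+m)

2+n≢n : ∀ {n} → 2 + n ≢ n
2+n≢n {n} e = m≢1+m+n n {1} (trans (sym e) (cong suc (+-comm 1 n)))

private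
  shift-i+j : ∀ i j k → suc i + suc j + k ≡ 2 + (i + j + k)
  shift-i+j = solve-∀
  shift-j+k : ∀ i j k → i + suc j + suc k ≡ 2 + (i + j + k)
  shift-j+k = solve-∀
  shift-i+k : ∀ i j k → suc i + j + suc k ≡ 2 + (i + j + k)
  shift-i+k = solve-∀
  shift-i : ∀ i j k → 2 + i + j + k ≡ 2 + (i + j + k)
  shift-i = solve-∀
  shift-j : ∀ i j k → i + (2 + j) + k ≡ 2 + (i + j + k)
  shift-j = solve-∀
  shift-k : ∀ i j k → i + j + (2 + k) ≡ 2 + (i + j + k)
  shift-k = solve-∀

≡2+⇒≢ : ∀ {m n} → m ≡ 2 + n → m ≢ n
≡2+⇒≢ m≡2+n m≡n = 2+n≢n (trans (sym m≡2+n) m≡n)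

adjacent⇒move : ∀ i j k i′ j′ k′ → i + j + k ≡ i′ + j′ + k′ →
                ∣ i - i′ ∣ + ∣ j - j′ ∣ + ∣ k - k′ ∣ ≡ 2 → Move (i , j , k) (i′ , j′ , k′)
adjacent⇒move i j k i′ j′ k′ s e
  with ∣ i - i′ ∣ in di | ∣ j - j′ ∣ in dj | ∣ k - k′ ∣ in dk
... | 0 | 1 | 1 with ∣m-n∣≡0⇒m≡n {i} di | ∣m-n∣≡1⇒ {j} dj | ∣m-n∣≡1⇒ {k} dk
...   | refl | inj₁ refl | inj₂ refl = j↝k
...   | refl | inj₂ refl | inj₁ refl = k↝j
...   | refl | inj₁ refl | inj₁ refl = ⊥-elim (≡2+⇒≢ (shift-j+k i j′ k′) s)
...   | refl | inj₂ refl | inj₂ refl = ⊥-elim (≡2+⇒≢ (shift-j+k i j k) (sym s))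
adjacent⇒move i j k i′ j′ k′ s e | 1 | 0 | 1
  with ∣m-n∣≡1⇒ {i} di | ∣m-n∣≡0⇒m≡n {j} dj | ∣m-n∣≡1⇒ {k} dk
...   | inj₁ refl | refl | inj₂ refl = i↝k
...   | inj₂ refl | refl | inj₁ refl = k↝i
...   | inj₁ refl | refl | inj₁ refl = ⊥-elim (≡2+⇒≢ (shift-i+k i′ j k′) s)
...   | inj₂ refl | refl | inj₂ refl = ⊥-elim (≡2+⇒≢ (shift-i+k i j k) (sym s))
adjacent⇒move i j k i′ j′ k′ s e | 1 | 1 | 0
  with ∣m-n∣≡1⇒ {i} di | ∣m-n∣≡1⇒ {j} dj | ∣m-n∣≡0⇒m≡n {k} dk
...   | inj₁ refl | inj₂ refl | refl = i↝j
...   | inj₂ refl | inj₁ refl | refl = j↝i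
...   | inj₁ refl | inj₁ refl | refl = ⊥-elim (≡2+⇒≢ (shift-i+j i′ j′ k) s)
...   | inj₂ refl | inj₂ refl | refl = ⊥-elim (≡2+⇒≢ (shift-i+j i j k) (sym s))
adjacent⇒move i j k i′ j′ k′ s e | 2 | 0 | 0
  with ∣m-n∣≡2⇒ {i} di | ∣m-n∣≡0⇒m≡n {j} dj | ∣m-n∣≡0⇒m≡n {k} dk
...   | inj₁ refl | refl | refl = ⊥-elim (≡2+⇒≢ (shift-i i′ j k) s)
...   | inj₂ refl | refl | refl = ⊥-elim (≡2+⇒≢ (shift-i i j k) (sym s))
adjacent⇒move i j k i′ j′ k′ s e | 0 | 2 | 0
  with ∣m-n∣≡0⇒m≡n {i} di | ∣m-n∣≡2⇒ {j} dj | ∣m-n∣≡0⇒m≡n {k} dk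
...   | refl | inj₁ refl | refl = ⊥-elim (≡2+⇒≢ (shift-j i j′ k) s)
...   | refl | inj₂ refl | refl = ⊥-elim (≡2+⇒≢ (shift-j i j k) (sym s))
adjacent⇒move i j k i′ j′ k′ s e | 0 | 0 | 2
  with ∣m-n∣≡0⇒m≡n {i} di | ∣m-n∣≡0⇒m≡n {j} dj | ∣m-n∣≡2⇒ {k} dk
...   | refl | refl | inj₁ refl = ⊥-elim (≡2+⇒≢ (shift-k i j k′) s)
...   | refl | refl | inj₂ refl = ⊥-elim (≡2+⇒≢ (shift-k i j k) (sym s))

adj⇒move : ∀ {r} (u v : Vertex r) → Adj r u v → Move (proj₁ u) (proj₁ v)
adj⇒move ((i , j , k) , p) ((i′ , j′ , k′) , q) = adjacent⇒move i j k i′ j′ k′ (trans p (sym q))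

∣n-1+n∣≡1 : ∀ n → ∣ n - suc n ∣ ≡ 1
∣n-1+n∣≡1 zero    = refl
∣n-1+n∣≡1 (suc n) = ∣n-1+n∣≡1 n

∣1+n-n∣≡1 : ∀ n → ∣ suc n - n ∣ ≡ 1
∣1+n-n∣≡1 n = trans (∣-∣-comm (suc n) n) (∣n-1+n∣≡1 n)

move⇒adj : ∀ {a b} → Move a b →
           ∣ proj₁ a - proj₁ b ∣ + ∣ proj₁ (proj₂ a) - proj₁ (proj₂ b) ∣
             + ∣ proj₂ (proj₂ a) - proj₂ (proj₂ b) ∣ ≡ 2
move⇒adj (i↝j {i} {j} {k}) rewrite ∣1+n-n∣≡1 i | ∣n-1+n∣≡1 j | ∣n-n∣≡0 k = refl
move⇒adj (j↝i {i} {j} {k}) rewrite ∣n-1+n∣≡1 i | ∣1+n-n∣≡1 j | ∣n-n∣≡0 k = refl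
move⇒adj (j↝k {i} {j} {k}) rewrite ∣n-n∣≡0 i | ∣1+n-n∣≡1 j | ∣n-1+n∣≡1 k = refl
move⇒adj (k↝j {i} {j} {k}) rewrite ∣n-n∣≡0 i | ∣n-1+n∣≡1 j | ∣1+n-n∣≡1 k = refl
move⇒adj (k↝i {i} {j} {k}) rewrite ∣n-1+n∣≡1 i | ∣n-n∣≡0 j | ∣1+n-n∣≡1 k = refl
move⇒adj (i↝k {i} {j} {k}) rewrite ∣1+n-n∣≡1 i | ∣n-n∣≡0 j | ∣n-1+n∣≡1 k = refl

-- ij R i j k orients the edge between (i , j , k) and (i - 1 , j + 1 , k), indexed by
-- its endpoint with the larger first coordinate; true means "away from that endpoint".
-- jk and ki are indexed likewise by the larger second, resp. third, coordinate.
record Rule : Set where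
  field
    ij jk ki : ℕ → ℕ → ℕ → Bool

open Rule

permits : ∀ {a b} → Rule → Move a b → Bool
permits R (i↝j {i} {j} {k}) = ij R (suc i) j k
permits R (j↝i {i} {j} {k}) = not (ij R (suc i) j k)
permits R (j↝k {i} {j} {k}) = jk R i (suc j) k
permits R (k↝j {i} {j} {k}) = not (jk R i (suc j) k)
permits R (k↝i {i} {j} {k}) = ki R i j (suc k)
permits R (i↝k {i} {j} {k}) = not (ki R i j (suc k))

reverse : ∀ {a b} → Move a b → Move b a
reverse i↝j = j↝i
reverse j↝i = i↝j
reverse j↝k = k↝j
reverse k↝j = j↝k
reverse k↝i = i↝k
reverse i↝k = k↝i

permits-reverse : ∀ R {a b} (m : Move a b) → permits R (reverse m) ≡ not (permits R m)
permits-reverse R i↝j = refl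
permits-reverse R j↝i = sym (not-involutive _)
permits-reverse R j↝k = refl
permits-reverse R k↝j = sym (not-involutive _)
permits-reverse R k↝i = refl
permits-reverse R i↝k = sym (not-involutive _)

direction : Rule → Triple → Triple → Bool
direction R (i , j , k) (i′ , j′ , k′) =
  if i ≡ᵇ i′ then (if j ≡ᵇ suc j′ then jk R i j k else not (jk R i′ j′ k′))
  else if j ≡ᵇ j′ then (if k ≡ᵇ suc k′ then ki R i j k else not (ki R i′ j′ k′))
  else (if i ≡ᵇ suc i′ then ij R i j k else not (ij R i′ j′ k′))

≡ᵇ-refl : ∀ n → (n ≡ᵇ n) ≡ true
≡ᵇ-refl zero    = refl
≡ᵇ-refl (suc n) = ≡ᵇ-refl n

≢⇒≡ᵇ-false : ∀ {m n} → m ≢ n → (m ≡ᵇ n) ≡ false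
≢⇒≡ᵇ-false {zero}  {zero}  m≢n = ⊥-elim (m≢n refl)
≢⇒≡ᵇ-false {zero}  {suc n} _   = refl
≢⇒≡ᵇ-false {suc m} {zero}  _   = refl
≢⇒≡ᵇ-false {suc m} {suc n} m≢n = ≢⇒≡ᵇ-false (λ m≡n → m≢n (cong suc m≡n))

direction-move : ∀ R {a b} (m : Move a b) → direction R a b ≡ permits R m
direction-move R (i↝j {i} {j})
  rewrite ≢⇒≡ᵇ-false (1+n≢n {i}) | ≢⇒≡ᵇ-false (≢-sym (1+n≢n {j})) | ≡ᵇ-refl i = refl
direction-move R (j↝i {i} {j})
  rewrite ≢⇒≡ᵇ-false (≢-sym (1+n≢n {i})) | ≢⇒≡ᵇ-false (1+n≢n {j})
        | ≢⇒≡ᵇ-false (≢-sym (2+n≢n {i})) = refl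
direction-move R (j↝k {i} {j})
  rewrite ≡ᵇ-refl i | ≡ᵇ-refl j = refl
direction-move R (k↝j {i} {j})
  rewrite ≡ᵇ-refl i | ≢⇒≡ᵇ-false (≢-sym (2+n≢n {j})) = refl
direction-move R (k↝i {i} {j} {k})
  rewrite ≢⇒≡ᵇ-false (≢-sym (1+n≢n {i})) | ≡ᵇ-refl j | ≡ᵇ-refl k = refl
direction-move R (i↝k {i} {j} {k})
  rewrite ≢⇒≡ᵇ-false (1+n≢n {i}) | ≡ᵇ-refl j | ≢⇒≡ᵇ-false (≢-sym (2+n≢n {k})) = refl

direction-antisym : ∀ R {a b} → Move a b → direction R a b ≡ not (direction R b a)
direction-antisym R {a} {b} m = begin
  direction R a b                ≡⟨ direction-move R m ⟩
  permits R m                    ≡⟨ not-involutive _ ⟨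
  not (not (permits R m))        ≡⟨ cong not (permits-reverse R m) ⟨
  not (permits R (reverse m))    ≡⟨ cong not (direction-move R (reverse m)) ⟨
  not (direction R b a)          ∎
  where open ≡-Reasoning

orientation : Rule → (r : ℕ) → Orientation r
orientation R r = record
  { dir     = λ u v → direction R (proj₁ u) (proj₁ v)
  ; antisym = λ u v adj → direction-antisym R (adj⇒move u v adj)
  }

Step : Rule → Triple → Triple → Set
Step R a b = Σ (Move a b) λ m → permits R m ≡ true

infixr 5 _◅_

data Path (R : Rule) : ℕ → Triple → Triple → Set where
  ε   : ∀ {a} → Path R 0 a a
  _◅_ : ∀ {n a b c} → Step R a b → Path R n b c → Path R (suc n) a c

_◅◅_ : ∀ {R m n a b c} → Path R m a b → Path R n b c → Path R (m + n) a c
ε        ◅◅ q = q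
(s ◅ p) ◅◅ q = s ◅ (p ◅◅ q)

_▻_ : ∀ {R n a b c} → Path R n a b → Step R b c → Path R (suc n) a c
ε       ▻ t = t ◅ ε
(s ◅ p) ▻ t = s ◅ (p ▻ t)

Reach : Rule → ℕ → Triple → Triple → Set
Reach R n a b = ∃ λ L → L ≤ n × Path R L a b

path⇒reach : ∀ {R n a b} → Path R n a b → Reach R n a b
path⇒reach {n = n} p = n , ≤-refl , p

_◅◅ʳ_ : ∀ {R m n a b c} → Reach R m a b → Reach R n b c → Reach R (m + n) a c
(L , L≤m , p) ◅◅ʳ (L′ , L′≤n , q) = L + L′ , +-mono-≤ L≤m L′≤n , p ◅◅ q

reach-mono : ∀ {R m n a b} → m ≤ n → Reach R m a b → Reach R n a b
reach-mono m≤n (L , L≤m , p) = L , ≤-trans L≤m m≤n , p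

move-total : ∀ {a b} → Move a b → total a ≡ total b
move-total (i↝j {i} {j} {k}) = cong (_+ k) (sym (+-suc i j))
move-total (j↝i {i} {j} {k}) = cong (_+ k) (+-suc i j)
move-total (j↝k {i} {j} {k}) = trans (cong (_+ k) (+-suc i j)) (sym (+-suc (i + j) k))
move-total (k↝j {i} {j} {k}) = trans (+-suc (i + j) k) (cong (_+ k) (sym (+-suc i j)))
move-total (k↝i {i} {j} {k}) = +-suc (i + j) k
move-total (i↝k {i} {j} {k}) = sym (+-suc (i + j) k)

step⇒arc : ∀ {R r a b} (s : Step R a b) (p : total a ≡ r) (q : total b ≡ r) →
           Arc (orientation R r) (a , p) (b , q)
step⇒arc {R} (m , allowed) p q = move⇒adj m , trans (direction-move R m) allowed

path⇒walk : ∀ {R r n a b} → Path R n a b → (p : total a ≡ r) (q : total b ≡ r) →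
            Walk (orientation R r) n (a , p) (b , q)
path⇒walk ε p q rewrite ≡-irrelevant p q = here
path⇒walk {r = r} (_◅_ {b = b} s rest) p q = step (step⇒arc s p p′) (path⇒walk rest p′ q)
  where
    p′ : total b ≡ r
    p′ = trans (sym (move-total (proj₁ s))) p

reach⇒reachWithin : ∀ {R r n a b} → Reach R n a b → (p : total a ≡ r) (q : total b ≡ r) →
                    ReachWithin (orientation R r) n (a , p) (b , q)
reach⇒reachWithin (L , L≤n , path) p q = L , L≤n , path⇒walk path p q

map-path : ∀ {R R′} (φ : Triple → Triple) → (∀ {a b} → Step R a b → Step R′ (φ a) (φ b)) →
           ∀ {n a b} → Path R n a b → Path R′ n (φ a) (φ b)
map-path φ f ε       = ε
map-path φ f (s ◅ p) = f s ◅ map-path φ f p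

map-reach : ∀ {R R′} (φ : Triple → Triple) → (∀ {a b} → Step R a b → Step R′ (φ a) (φ b)) →
            ∀ {n a b} → Reach R n a b → Reach R′ n (φ a) (φ b)
map-reach φ f (L , L≤n , p) = L , L≤n , map-path φ f p

along-i↝j : ∀ {R} k → (∀ x y → ij R (suc x) y k ≡ true) →
            ∀ t i j → Path R t (t + i , j , k) (i , t + j , k)
along-i↝j k h zero    i j = ε
along-i↝j {R} k h (suc t) i j =
  (i↝j , h (t + i) j) ◅ subst (λ z → Path R t (t + i , suc j , k) (i , z , k)) (+-suc t j)
                                 (along-i↝j k h t i (suc j))

along-j↝i : ∀ {R} k → (∀ x y → ij R (suc x) y k ≡ false) →
            ∀ t i j → Path R t (i , t + j , k) (t + i , j , k)
along-j↝i k h zero    i j = ε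
along-j↝i {R} k h (suc t) i j =
  (j↝i , cong not (h i (t + j))) ◅ subst (λ z → Path R t (suc i , t + j , k) (z , j , k)) (+-suc t i)
                                          (along-j↝i k h t (suc i) j)

row-i↝j : ∀ {R} k → (∀ x y → ij R (suc x) y k ≡ true) →
          ∀ {i₀ j₀ i₁ j₁} → i₁ ≤ i₀ → i₀ + j₀ ≡ i₁ + j₁ →
          Path R (i₀ ∸ i₁) (i₀ , j₀ , k) (i₁ , j₁ , k)
row-i↝j {R} k h {i₀} {j₀} {i₁} {j₁} i₁≤i₀ same =
  subst₂ (λ x y → Path R t (x , j₀ , k) (i₁ , y , k)) t+i₁≡i₀ t+j₀≡j₁ (along-i↝j k h t i₁ j₀)
  where
    t : ℕ
    t = i₀ ∸ i₁
    t+i₁≡i₀ : t + i₁ ≡ i₀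
    t+i₁≡i₀ = m∸n+n≡m i₁≤i₀
    t+j₀≡j₁ : t + j₀ ≡ j₁
    t+j₀≡j₁ = +-cancelˡ-≡ i₁ _ _ (begin
      i₁ + (t + j₀)   ≡⟨ +-assoc i₁ t j₀ ⟨
      i₁ + t + j₀     ≡⟨ cong (_+ j₀) (trans (+-comm i₁ t) t+i₁≡i₀) ⟩
      i₀ + j₀         ≡⟨ same ⟩
      i₁ + j₁         ∎)
      where open ≡-Reasoning

row-j↝i : ∀ {R} k → (∀ x y → ij R (suc x) y k ≡ false) →
          ∀ {i₀ j₀ i₁ j₁} → i₀ ≤ i₁ → i₀ + j₀ ≡ i₁ + j₁ →
          Path R (i₁ ∸ i₀) (i₀ , j₀ , k) (i₁ , j₁ , k)
row-j↝i {R} k h {i₀} {j₀} {i₁} {j₁} i₀≤i₁ same =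
  subst₂ (λ x y → Path R t (i₀ , x , k) (y , j₁ , k)) t+j₁≡j₀ t+i₀≡i₁ (along-j↝i k h t i₀ j₁)
  where
    t : ℕ
    t = i₁ ∸ i₀
    t+i₀≡i₁ : t + i₀ ≡ i₁
    t+i₀≡i₁ = m∸n+n≡m i₀≤i₁
    t+j₁≡j₀ : t + j₁ ≡ j₀
    t+j₁≡j₀ = +-cancelˡ-≡ i₀ _ _ (begin
      i₀ + (t + j₁)   ≡⟨ +-assoc i₀ t j₁ ⟨
      i₀ + t + j₁     ≡⟨ cong (_+ j₁) (trans (+-comm i₀ t) t+i₀≡i₁) ⟩
      i₁ + j₁         ≡⟨ same ⟨
      i₀ + j₀         ∎)
      where open ≡-Reasoning

-- Every line of the grid is directed uniformly, and parallel lines alternate.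
evenRule : Rule
evenRule = record { ij = λ i j k → odd k ; jk = λ i j k → odd i ; ki = λ i j k → odd j }

-- Above row 0 this is evenRule shifted up by one row (see lift₁-step); row 0 runs
-- towards j, and the edges between rows 0 and 1 run up along jk and down along ki.
oddRule : Rule
oddRule = record { ij = λ i j k → not (odd k) ; jk = oddJK ; ki = oddKI }
  where
    oddJK : ℕ → ℕ → ℕ → Bool
    oddJK i j zero    = true
    oddJK i j (suc k) = odd i
    oddKI : ℕ → ℕ → ℕ → Bool
    oddKI i j 1 = true
    oddKI i j _ = odd j

lift₁ : Triple → Triple
lift₁ (i , j , k) = i , j , suc k

lift₂ : Triple → Triple
lift₂ = lift₁ ∘ lift₁

lift₂-step : ∀ {a b} → Step evenRule a b → Step evenRule (lift₂ a) (lift₂ b)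
lift₂-step (i↝j , e) = i↝j , e
lift₂-step (j↝i , e) = j↝i , e
lift₂-step (j↝k , e) = j↝k , e
lift₂-step (k↝j , e) = k↝j , e
lift₂-step (k↝i , e) = k↝i , e
lift₂-step (i↝k , e) = i↝k , e

lift₁-step : ∀ {a b} → Step evenRule a b → Step oddRule (lift₁ a) (lift₁ b)
lift₁-step (i↝j {k = k} , e) = i↝j , trans (not-odd-suc k) e
lift₁-step (j↝i {k = k} , e) = j↝i , trans (cong not (not-odd-suc k)) e
lift₁-step (j↝k , e) = j↝k , e
lift₁-step (k↝j , e) = k↝j , e
lift₁-step (k↝i , e) = k↝i , e
lift₁-step (i↝k , e) = i↝k , e

swap : Triple → Triple
swap (i , j , k) = j , i , k

total-swap : ∀ a → total (swap a) ≡ total a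
total-swap (i , j , k) = cong (_+ k) (+-comm j i)

swap-step : ∀ {a b} → Step evenRule a b → Step evenRule (swap b) (swap a)
swap-step (i↝j , e) = i↝j , e
swap-step (j↝i , e) = j↝i , e
swap-step (j↝k , e) = k↝i , e
swap-step (k↝j , e) = i↝k , e
swap-step (k↝i , e) = j↝k , e
swap-step (i↝k , e) = k↝j , e

swap-path : ∀ {n a b} → Path evenRule n a b → Path evenRule n (swap b) (swap a)
swap-path ε       = ε
swap-path (s ◅ p) = swap-path p ▻ swap-step s

swap-reach : ∀ {n a b} → Reach evenRule n a b → Reach evenRule n (swap b) (swap a)
swap-reach (L , L≤n , p) = L , L≤n , swap-path p

split-bound : ∀ {a b c m n} → a + c ≤ m → b ≤ n → a + b + c ≤ m + n
split-bound {a} {b} {c} {m} {n} a+c≤m b≤n = begin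
  a + b + c   ≡⟨ shift a b c ⟩
  a + c + b   ≤⟨ +-mono-≤ a+c≤m b≤n ⟩
  m + n       ∎
  where
    open ≤-Reasoning
    shift : ∀ x y z → x + y + z ≡ x + z + y
    shift = solve-∀

-- The band: rows 0 and 1 of evenRule on an even level

-- Row 0 runs towards i and row 1 towards j, so a route from u to v in the band enters
-- the row running the right way, follows it, and leaves it. The excess of an entry or
-- exit is the number of its steps not accounted for by progress in the first coordinate.
module Band {r : ℕ} (r-even : odd r ≡ false) where

  odd-sum : ∀ i j k → odd (i + j + k) ≡ (odd i xor odd j) xor odd k
  odd-sum i j k rewrite odd-+ (i + j) k | odd-+ i j = refl

  row₀-parity : ∀ i j → i + j + 0 ≡ r → odd j ≡ odd i
  row₀-parity i j s with trans (sym (odd-sum i j 0)) (trans (cong odd s) r-even)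
  ... | h with odd i | odd j
  ...   | false | false = refl
  ...   | true  | true  = refl
  row₀-parity _ _ _ | () | false | true
  row₀-parity _ _ _ | () | true  | false

  row₁-parity : ∀ i j → i + j + 1 ≡ r → odd j ≡ not (odd i)
  row₁-parity i j s with trans (sym (odd-sum i j 1)) (trans (cong odd s) r-even)
  ... | h with odd i | odd j
  ...   | false | true  = refl
  ...   | true  | false = refl
  row₁-parity _ _ _ | () | false | false
  row₁-parity _ _ _ | () | true  | true

  Row₀ExitExcess : ℕ → ℕ → Set
  Row₀ExitExcess I e = (e ≡ 0 × I ≤ r) ⊎ (e ≡ 1 × suc I ≤ r) ⊎ (e ≡ 3 × I + 2 ≤ r)

  record Row₀Entry (i I : ℕ) (u : Triple) : Set where
    field
      i′ j′ cost excess : ℕ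
      path         : Path evenRule cost u (i′ , j′ , 0)
      on-level     : i′ + j′ ≡ r
      i′≤I         : i′ ≤ I
      balance      : cost + i ≡ excess + i′
      excess-cases : excess ≡ 0 ⊎ (excess ≡ 2 × 1 ≤ i)

  record Row₀Exit (I : ℕ) (v : Triple) : Set where
    field
      i′ j′ cost excess : ℕ
      path         : Path evenRule cost (i′ , j′ , 0) v
      on-level     : i′ + j′ ≡ r
      I≤i′         : I ≤ i′
      balance      : cost + i′ ≡ excess + I
      excess-cases : Row₀ExitExcess I excess

  record Row₁Entry (i I : ℕ) (u : Triple) : Set where
    field
      i′ j′ cost excess : ℕ
      path         : Path evenRule cost u (i′ , j′ , 1)
      on-level     : i′ + j′ + 1 ≡ r
      I≤i′         : I ≤ i′
      balance      : cost + i′ ≡ excess + i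
      excess-bound : excess + i ≤ r

  record Row₁Exit (I : ℕ) (v : Triple) : Set where
    field
      i′ j′ cost excess : ℕ
      path         : Path evenRule cost (i′ , j′ , 1) v
      on-level     : i′ + j′ + 1 ≡ r
      i′≤I         : i′ ≤ I
      balance      : cost + I ≡ excess + i′
      excess≤2     : excess ≤ 2
      excess≤1+I   : excess ≤ suc I

  via-row₀ : ∀ {i I u v n} (s : Row₀Entry i I u) (e : Row₀Exit I v) →
             Row₀Entry.excess s + Row₀Exit.excess e + I ≤ n + i → Reach evenRule n u v
  via-row₀ {i} {I} {n = n} s e bound =
    L , +-cancelʳ-≤ i L n (≤-trans (≤-reflexive L+i≡) bound) , S.path ◅◅ (along ◅◅ E.path)
    where
      module S = Row₀Entry s
      module E = Row₀Exit e
      t L : ℕ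
      t = E.i′ ∸ S.i′
      L = S.cost + (t + E.cost)
      along : Path evenRule t (S.i′ , S.j′ , 0) (E.i′ , E.j′ , 0)
      along = row-j↝i 0 (λ _ _ → refl) (≤-trans S.i′≤I E.I≤i′) (trans S.on-level (sym E.on-level))
      shuffle₁ : ∀ c i t c′ → c + (t + c′) + i ≡ (c + i) + (t + c′)
      shuffle₁ = solve-∀
      shuffle₂ : ∀ x i′ t c′ → x + i′ + (t + c′) ≡ x + (c′ + (t + i′))
      shuffle₂ = solve-∀
      L+i≡ : L + i ≡ S.excess + E.excess + I
      L+i≡ = begin
        L + i                                  ≡⟨ shuffle₁ S.cost i t E.cost ⟩
        (S.cost + i) + (t + E.cost)            ≡⟨ cong (_+ (t + E.cost)) S.balance ⟩
        S.excess + S.i′ + (t + E.cost)         ≡⟨ shuffle₂ S.excess S.i′ t E.cost ⟩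
        S.excess + (E.cost + (t + S.i′))       ≡⟨ cong (λ x → S.excess + (E.cost + x))
                                                       (m∸n+n≡m (≤-trans S.i′≤I E.I≤i′)) ⟩
        S.excess + (E.cost + E.i′)             ≡⟨ cong (S.excess +_) E.balance ⟩
        S.excess + (E.excess + I)              ≡⟨ +-assoc S.excess E.excess I ⟨
        S.excess + E.excess + I                ∎
        where open ≡-Reasoning

  via-row₁ : ∀ {i I u v n} (s : Row₁Entry i I u) (e : Row₁Exit I v) →
             Row₁Entry.excess s + Row₁Exit.excess e + i ≤ n + I → Reach evenRule n u v
  via-row₁ {i} {I} {n = n} s e bound =
    L , +-cancelʳ-≤ I L n (≤-trans (≤-reflexive L+I≡) bound) , S.path ◅◅ (along ◅◅ E.path)
    where
      module S = Row₁Entry s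
      module E = Row₁Exit e
      t L : ℕ
      t = S.i′ ∸ E.i′
      L = S.cost + (t + E.cost)
      along : Path evenRule t (S.i′ , S.j′ , 1) (E.i′ , E.j′ , 1)
      along = row-i↝j 1 (λ _ _ → refl) (≤-trans E.i′≤I S.I≤i′)
                (+-cancelʳ-≡ 1 _ _ (trans S.on-level (sym E.on-level)))
      shuffle₁ : ∀ c t c′ I → c + (t + c′) + I ≡ c + t + (c′ + I)
      shuffle₁ = solve-∀
      shuffle₂ : ∀ c t x i′ → c + t + (x + i′) ≡ c + (t + i′) + x
      shuffle₂ = solve-∀
      shuffle₃ : ∀ x i y → x + i + y ≡ x + y + i
      shuffle₃ = solve-∀
      L+I≡ : L + I ≡ S.excess + E.excess + i
      L+I≡ = begin
        L + I                                  ≡⟨ shuffle₁ S.cost t E.cost I ⟩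
        S.cost + t + (E.cost + I)              ≡⟨ cong (S.cost + t +_) E.balance ⟩
        S.cost + t + (E.excess + E.i′)         ≡⟨ shuffle₂ S.cost t E.excess E.i′ ⟩
        S.cost + (t + E.i′) + E.excess         ≡⟨ cong (λ x → S.cost + x + E.excess)
                                                       (m∸n+n≡m (≤-trans E.i′≤I S.I≤i′)) ⟩
        S.cost + S.i′ + E.excess               ≡⟨ cong (_+ E.excess) S.balance ⟩
        S.excess + i + E.excess                ≡⟨ shuffle₃ S.excess i E.excess ⟩
        S.excess + E.excess + i                ∎
        where open ≡-Reasoning

  enter₀-from₀ : ∀ {i j I} → i + j + 0 ≡ r → i ≤ I → Row₀Entry i I (i , j , 0)
  enter₀-from₀ {i} {j} s i≤I = record
    { i′ = i ; j′ = j ; cost = 0 ; excess = 0 ; path = ε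
    ; on-level = trans (sym (+-identityʳ (i + j))) s ; i′≤I = i≤I
    ; balance = refl ; excess-cases = inj₁ refl }

  enter₀-from₁ : ∀ {i j I} → i + j + 1 ≡ r → i ≤ I → (i ≡ I → odd i ≡ true) →
                 Row₀Entry i I (i , j , 1)
  enter₀-from₁ {i} {j} {I} s i≤I i≡I⇒odd with odd i in oi
  ... | false = record
    { i′ = suc i ; j′ = j ; cost = 1 ; excess = 0 ; path = (k↝i , oj) ◅ ε
    ; on-level = trans (sym (+-comm (i + j) 1)) s ; i′≤I = ≤∧≢⇒< i≤I i≢I
    ; balance = refl ; excess-cases = inj₁ refl }
    where
      oj : odd j ≡ true
      oj = trans (row₁-parity i j s) (cong not oi)
      i≢I : i ≢ I
      i≢I i≡I with i≡I⇒odd i≡I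
      ... | ()
  enter₀-from₁ {suc i} {j} s i≤I _ | true = record
    { i′ = suc i ; j′ = suc j ; cost = 2 ; excess = 2
    ; path = (i↝j , refl) ◅ (k↝i , trans (odd-suc j) (cong not oj)) ◅ ε
    ; on-level = trans (shift i j) s ; i′≤I = i≤I
    ; balance = refl ; excess-cases = inj₂ (refl , s≤s z≤n) }
    where
      oj : odd j ≡ false
      oj = trans (row₁-parity (suc i) j s) (cong not oi)
      shift : ∀ i j → suc i + suc j ≡ suc i + j + 1
      shift = solve-∀

  exit₀-to₀ : ∀ {I J} → I + J + 0 ≡ r → Row₀Exit I (I , J , 0)
  exit₀-to₀ {I} {J} s = record
    { i′ = I ; j′ = J ; cost = 0 ; excess = 0 ; path = ε
    ; on-level = trans (sym (+-identityʳ (I + J))) s ; I≤i′ = ≤-refl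
    ; balance = refl ; excess-cases = inj₁ (refl , coord≤total s) }

  exit₀-to₁ : ∀ {I J} → I + J + 1 ≡ r → Row₀Exit I (I , J , 1)
  exit₀-to₁ {I} {J} s with odd I in oI
  ... | true = record
    { i′ = I ; j′ = suc J ; cost = 1 ; excess = 1 ; path = (j↝k , oI) ◅ ε
    ; on-level = trans (shift I J) s ; I≤i′ = ≤-refl
    ; balance = refl ; excess-cases = inj₂ (inj₁ (refl , coord≤total (trans (shift′ I J) s))) }
    where
      shift : ∀ I J → I + suc J ≡ I + J + 1
      shift = solve-∀
      shift′ : ∀ I J → suc I + J + 0 ≡ I + J + 1
      shift′ = solve-∀
  exit₀-to₁ {I} {zero} s | false with trans (row₁-parity I 0 s) (cong not oI)
  ... | ()
  exit₀-to₁ {I} {suc J} s | false = record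
    { i′ = suc I ; j′ = suc J ; cost = 2 ; excess = 3
    ; path = (j↝k , trans (odd-suc I) (cong not oI)) ◅ (i↝j , refl) ◅ ε
    ; on-level = trans (shift I J) s ; I≤i′ = n≤1+n I
    ; balance = refl ; excess-cases = inj₂ (inj₂ (refl , coord≤total (trans (shift′ I J) s))) }
    where
      shift : ∀ I J → suc I + suc J ≡ I + suc J + 1
      shift = solve-∀
      shift′ : ∀ I J → I + 2 + J + 0 ≡ I + suc J + 1
      shift′ = solve-∀

  enter₁-from₁ : ∀ {i j I} → i + j + 1 ≡ r → I ≤ i → Row₁Entry i I (i , j , 1)
  enter₁-from₁ {i} {j} s I≤i = record
    { i′ = i ; j′ = j ; cost = 0 ; excess = 0 ; path = ε ; on-level = s ; I≤i′ = I≤i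
    ; balance = refl ; excess-bound = coord≤total s }

  enter₁-from₀ : ∀ {i j I} → i + j + 0 ≡ r → I < i → Row₁Entry i I (i , j , 0)
  enter₁-from₀ {suc i} {j} s (s≤s I≤i) with odd (suc i) in oi
  ... | false = record
    { i′ = i ; j′ = j ; cost = 1 ; excess = 0
    ; path = (i↝k , cong not (trans (row₀-parity (suc i) j s) oi)) ◅ ε
    ; on-level = trans (shift i j) s ; I≤i′ = I≤i
    ; balance = refl ; excess-bound = coord≤total s }
    where
      shift : ∀ i j → i + j + 1 ≡ suc i + j + 0
      shift = solve-∀
  enter₁-from₀ {suc i} {zero} s _ | true with trans (row₀-parity (suc i) 0 s) oi
  ... | ()
  enter₁-from₀ {suc i} {suc j} s (s≤s I≤i) | true = record
    { i′ = suc i ; j′ = j ; cost = 1 ; excess = 1 ; path = (j↝k , oi) ◅ ε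
    ; on-level = trans (shift i j) s ; I≤i′ = m≤n⇒m≤1+n I≤i
    ; balance = refl ; excess-bound = coord≤total (trans (shift′ i j) s) }
    where
      shift : ∀ i j → suc i + j + 1 ≡ suc i + suc j + 0
      shift = solve-∀
      shift′ : ∀ i j → 2 + i + j + 0 ≡ suc i + suc j + 0
      shift′ = solve-∀

  exit₁-to₁ : ∀ {I J} → I + J + 1 ≡ r → Row₁Exit I (I , J , 1)
  exit₁-to₁ {I} {J} s = record
    { i′ = I ; j′ = J ; cost = 0 ; excess = 0 ; path = ε ; on-level = s ; i′≤I = ≤-refl
    ; balance = refl ; excess≤2 = z≤n ; excess≤1+I = z≤n }

  exit₁-to₀ : ∀ {I J} → I + J + 0 ≡ r → I < r → Row₁Exit I (I , J , 0)
  exit₁-to₀ {I} {J} s I<r with odd I in oI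
  exit₁-to₀ {I} {zero} s I<r | false = ⊥-elim (<-irrefl (trans (sym (shift I)) s) I<r)
    where
      shift : ∀ I → I + 0 + 0 ≡ I
      shift = solve-∀
  exit₁-to₀ {I} {suc J} s _ | false = record
    { i′ = I ; j′ = J ; cost = 1 ; excess = 1 ; path = (k↝j , cong not oI) ◅ ε
    ; on-level = trans (shift I J) s ; i′≤I = ≤-refl
    ; balance = refl ; excess≤2 = s≤s z≤n ; excess≤1+I = s≤s z≤n }
    where
      shift : ∀ I J → I + J + 1 ≡ I + suc J + 0
      shift = solve-∀
  exit₁-to₀ {suc I} {J} s _ | true = record
    { i′ = I ; j′ = J ; cost = 1 ; excess = 2
    ; path = (k↝i , trans (row₀-parity (suc I) J s) oI) ◅ ε
    ; on-level = trans (shift I J) s ; i′≤I = n≤1+n I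
    ; balance = refl ; excess≤2 = ≤-refl ; excess≤1+I = s≤s (s≤s z≤n) }
    where
      shift : ∀ I J → I + J + 1 ≡ suc I + J + 0
      shift = solve-∀

  row₀-exit-bound : ∀ {I e} → Row₀ExitExcess I e → e + I ≤ suc r
  row₀-exit-bound (inj₁ (refl , I≤r))            = m≤n⇒m≤1+n I≤r
  row₀-exit-bound (inj₂ (inj₁ (refl , 1+I≤r)))   = m≤n⇒m≤1+n 1+I≤r
  row₀-exit-bound {I} (inj₂ (inj₂ (refl , I+2≤r))) =
    ≤-trans (≤-reflexive (trans (+-comm 3 I) (+-suc I 2))) (s≤s I+2≤r)

  row₀-exit-excess-3 : ∀ {I e} → Row₀ExitExcess I e → e ≡ 3 → I + 2 ≤ r
  row₀-exit-excess-3 (inj₁ (refl , _))          ()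
  row₀-exit-excess-3 (inj₂ (inj₁ (refl , _)))   ()
  row₀-exit-excess-3 (inj₂ (inj₂ (_ , I+2≤r))) _ = I+2≤r

  row₀-entry-excess-2 : ∀ {i I u} (s : Row₀Entry i I u) → Row₀Entry.excess s ≡ 2 → 1 ≤ i
  row₀-entry-excess-2 s e₀≡2 with Row₀Entry.excess-cases s
  ... | inj₂ (_ , 1≤i) = 1≤i
  row₀-entry-excess-2 s () | inj₁ refl

  row₀-bound : ∀ {i I e₀ e₁} → e₀ ≡ 0 ⊎ (e₀ ≡ 2 × 1 ≤ i) → Row₀ExitExcess I e₁ →
               (e₀ ≡ 2 → e₁ ≡ 3 → 2 ≤ i ⊎ I + 3 ≤ r) → e₀ + e₁ + I ≤ suc r + i
  row₀-bound {i} (inj₁ refl) exit _ = ≤-trans (row₀-exit-bound exit) (m≤m+n (suc r) i)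
  row₀-bound {I = I} (inj₂ (refl , 1≤i)) (inj₁ (refl , I≤r)) _ =
    ≤-trans (≤-reflexive (cong suc (+-comm 1 I))) (+-mono-≤ (s≤s I≤r) 1≤i)
  row₀-bound {I = I} (inj₂ (refl , 1≤i)) (inj₂ (inj₁ (refl , 1+I≤r))) _ =
    ≤-trans (≤-reflexive (cong (suc ∘ suc) (+-comm 1 I))) (+-mono-≤ (s≤s 1+I≤r) 1≤i)
  row₀-bound {I = I} (inj₂ (refl , 1≤i)) (inj₂ (inj₂ (refl , I+2≤r))) special
    with special refl refl
  ... | inj₁ 2≤i   = ≤-trans (≤-reflexive (shift I)) (+-mono-≤ (s≤s I+2≤r) 2≤i)
    where
      shift : ∀ I → 2 + 3 + I ≡ suc (I + 2) + 2
      shift = solve-∀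
  ... | inj₂ I+3≤r = ≤-trans (≤-reflexive (shift I)) (+-mono-≤ (s≤s I+3≤r) 1≤i)
    where
      shift : ∀ I → 2 + 3 + I ≡ suc (I + 3) + 1
      shift = solve-∀

  route-row₀ : ∀ {i I u v} (s : Row₀Entry i I u) (e : Row₀Exit I v) →
               (Row₀Entry.excess s ≡ 2 → Row₀Exit.excess e ≡ 3 → 2 ≤ i ⊎ I + 3 ≤ r) →
               Reach evenRule (suc r) u v
  route-row₀ s e special =
    via-row₀ s e (row₀-bound (Row₀Entry.excess-cases s) (Row₀Exit.excess-cases e) special)

  route-row₁ : ∀ {i I u v} (s : Row₁Entry i I u) (e : Row₁Exit I v) → Reach evenRule (suc r) u v
  route-row₁ {i} {I} s e = via-row₁ s e (begin
    _ ≤⟨ split-bound {c = i} (Row₁Entry.excess-bound s) (Row₁Exit.excess≤1+I e) ⟩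
    r + suc I ≡⟨ +-suc r I ⟩
    suc r + I ∎)
    where open ≤-Reasoning

  stay-or-enter : ∀ i I → (i ≡ I × odd i ≡ false) ⊎ (i ≡ I → odd i ≡ true)
  stay-or-enter i I with i ≟ I | odd i
  ... | yes i≡I | false = inj₁ (i≡I , refl)
  ... | yes _   | true  = inj₂ (λ _ → refl)
  ... | no i≢I  | _     = inj₂ (λ i≡I → ⊥-elim (i≢I i≡I))

  band₀₀ : ∀ {i j I J} → i + j + 0 ≡ r → I + J + 0 ≡ r → Reach evenRule (suc r) (i , j , 0) (I , J , 0)
  band₀₀ {i} {I = I} s t with i ≤? I
  ... | yes i≤I = route-row₀ (enter₀-from₀ s i≤I) (exit₀-to₀ t) (λ ())
  ... | no i≰I  = route-row₁ (enter₁-from₀ s I<i) (exit₁-to₀ t (<-≤-trans I<i (coord≤total s)))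
    where
      I<i : I < i
      I<i = ≰⇒> i≰I

  band₀₁ : ∀ {i j I J} → i + j + 0 ≡ r → I + J + 1 ≡ r → Reach evenRule (suc r) (i , j , 0) (I , J , 1)
  band₀₁ {i} {I = I} s t with i ≤? I
  ... | yes i≤I = route-row₀ (enter₀-from₀ s i≤I) (exit₀-to₁ t) (λ ())
  ... | no i≰I  = route-row₁ (enter₁-from₀ s (≰⇒> i≰I)) (exit₁-to₁ t)

  band₁₀ : ∀ {i j I J} → i + j + 1 ≡ r → I + J + 0 ≡ r → Reach evenRule (suc r) (i , j , 1) (I , J , 0)
  band₁₀ {i} {j} {I} {J} s t with i ≤? I
  ... | no i≰I  =
    route-row₁ (enter₁-from₁ s (<⇒≤ I<i)) (exit₁-to₀ t (<-≤-trans I<i (coord≤total s)))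
    where
      I<i : I < i
      I<i = ≰⇒> i≰I
  ... | yes i≤I with stay-or-enter i I
  ...   | inj₂ enter        = route-row₀ (enter₀-from₁ s i≤I enter) (exit₀-to₀ t) (λ _ ())
  ...   | inj₁ (refl , even) =
    1 , s≤s z≤n , subst (λ x → Path evenRule 1 (i , j , 1) (i , x , 0)) 1+j≡J ((k↝j , cong not even) ◅ ε)
    where
      1+j≡J : suc j ≡ J
      1+j≡J = +-cancelˡ-≡ i _ _ (trans (shift i j) (trans s (trans (sym t) (+-identityʳ (i + J)))))
        where
          shift : ∀ i j → i + suc j ≡ i + j + 1
          shift = solve-∀

  row₂-shortcut : ∀ t → Path evenRule (2 + t) (1 , 2 + t , 1) (2 + t , 1 , 1)
  row₂-shortcut t =
    (j↝k , refl) ◅ (row-j↝i 2 (λ _ _ → refl) (s≤s z≤n) (+-comm 1 (suc t)) ▻ (k↝i , refl))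

  -- From (1 , r - 2 , 1) to (r - 2 , 1 , 1) both detours through row 0 are needed,
  -- which is one step too many; row 2 gives a shortcut.
  band₁₁-shortcut : 4 ≤ r → ∀ {j I J} → 1 + j + 1 ≡ r → I + J + 1 ≡ r → I + 2 ≡ r →
                  Reach evenRule (suc r) (1 , j , 1) (I , J , 1)
  band₁₁-shortcut 4≤r {I = 0}     _ _ I+2≡r = ⊥-elim (<-irrefl I+2≡r (≤-trans (n≤1+n 3) 4≤r))
  band₁₁-shortcut 4≤r {I = 1}     _ _ I+2≡r = ⊥-elim (<-irrefl I+2≡r 4≤r)
  band₁₁-shortcut 4≤r {j} {suc (suc t)} {J} s u I+2≡r =
    2 + t , ≤-trans (m≤m+n (2 + t) 2) (≤-trans (≤-reflexive I+2≡r) (n≤1+n r)) ,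
    subst₂ (λ x y → Path evenRule (2 + t) (1 , x , 1) (2 + t , y , 1)) j≡ J≡ (row₂-shortcut t)
    where
      shift₁ : ∀ t → 2 + t + 2 ≡ 1 + (2 + t) + 1
      shift₁ = solve-∀
      shift₂ : ∀ t → 2 + t + 2 ≡ 2 + t + 1 + 1
      shift₂ = solve-∀
      j≡ : 2 + t ≡ j
      j≡ = +-cancelˡ-≡ 1 _ _ (+-cancelʳ-≡ 1 _ _ (trans (sym (shift₁ t)) (trans I+2≡r (sym s))))
      J≡ : 1 ≡ J
      J≡ = +-cancelˡ-≡ (2 + t) _ _ (+-cancelʳ-≡ 1 _ _ (trans (sym (shift₂ t)) (trans I+2≡r (sym u))))

  band₁₁-forward : 4 ≤ r → ∀ {i j I J} → i + j + 1 ≡ r → I + J + 1 ≡ r → i ≤ I →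
                   (i ≡ I → odd i ≡ true) → Reach evenRule (suc r) (i , j , 1) (I , J , 1)
  band₁₁-forward 4≤r {i} {j} {I} {J} s t i≤I enter with 2 ≤? i | I + 2 ≟ r
  ... | yes 2≤i | _ = route-row₀ (enter₀-from₁ s i≤I enter) (exit₀-to₁ t) (λ _ _ → inj₁ 2≤i)
  ... | no _ | no I+2≢r = route-row₀ (enter₀-from₁ s i≤I enter) exit
    (λ _ e₁≡3 → inj₂ (≤-trans (≤-reflexive (+-suc I 2))
                               (≤∧≢⇒< (row₀-exit-excess-3 (Row₀Exit.excess-cases exit) e₁≡3) I+2≢r)))
    where
      exit : Row₀Exit I (I , J , 1)
      exit = exit₀-to₁ t
  band₁₁-forward 4≤r {zero} {j} {I} {J} s t i≤I enter | no _ | yes _ =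
    route-row₀ entry exit impossible
    where
      entry : Row₀Entry 0 I (0 , j , 1)
      entry = enter₀-from₁ s i≤I enter
      exit : Row₀Exit I (I , J , 1)
      exit = exit₀-to₁ t
      impossible : Row₀Entry.excess entry ≡ 2 → Row₀Exit.excess exit ≡ 3 → 2 ≤ 0 ⊎ I + 3 ≤ r
      impossible e₀≡2 with row₀-entry-excess-2 entry e₀≡2
      ... | ()
  band₁₁-forward 4≤r {suc zero} s t _ _ | no _ | yes I+2≡r = band₁₁-shortcut 4≤r s t I+2≡r
  band₁₁-forward 4≤r {suc (suc i)} _ _ _ _ | no 2≰i | yes _ = ⊥-elim (2≰i (s≤s (s≤s z≤n)))

  band₁₁ : 4 ≤ r → ∀ {i j I J} → i + j + 1 ≡ r → I + J + 1 ≡ r →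
           Reach evenRule (suc r) (i , j , 1) (I , J , 1)
  band₁₁ 4≤r {i} {j} {I} {J} s t with i ≤? I
  ... | no i≰I  = route-row₁ (enter₁-from₁ s (<⇒≤ (≰⇒> i≰I))) (exit₁-to₁ t)
  ... | yes i≤I with stay-or-enter i I
  ...   | inj₂ enter    = band₁₁-forward 4≤r s t i≤I enter
  ...   | inj₁ (refl , _) =
    0 , z≤n , subst (λ x → Path evenRule 0 (i , j , 1) (i , x , 1)) j≡J ε
    where
      j≡J : j ≡ J
      j≡J = +-cancelˡ-≡ i _ _ (+-cancelʳ-≡ 1 _ _ (trans s (sym t)))

  via-row₀-from-near-cornerⱼ : ∀ {j I v} → 1 + j + 0 ≡ r → Row₀Exit (suc I) v →
                               Reach evenRule r (1 , j , 0) v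
  via-row₀-from-near-cornerⱼ s e = via-row₀ (enter₀-from₀ s (s≤s z≤n)) e
    (≤-trans (row₀-exit-bound (Row₀Exit.excess-cases e)) (≤-reflexive (+-comm 1 r)))

  from-near-cornerⱼ : 3 ≤ r → ∀ {j I J k} → 1 + j + 0 ≡ r → k ≤ 1 → I + J + k ≡ r →
           Reach evenRule r (1 , j , 0) (I , J , k)
  from-near-cornerⱼ _ {I = suc I} {k = 0}     s _ t = via-row₀-from-near-cornerⱼ s (exit₀-to₀ t)
  from-near-cornerⱼ _ {I = suc I} {k = 1}     s _ t = via-row₀-from-near-cornerⱼ s (exit₀-to₁ t)
  from-near-cornerⱼ _ {I = suc I} {k = suc (suc _)} _ (s≤s ()) _
  from-near-cornerⱼ 3≤r {zero} s _ _ with subst (3 ≤_) (sym s) 3≤r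
  ... | s≤s ()
  from-near-cornerⱼ 3≤r {suc j} {zero} {J} {zero} s _ t =
    3 , 3≤r , subst (λ x → Path evenRule 3 (1 , suc j , 0) (0 , x , 0)) 2+j≡J
                    ((j↝k , refl) ◅ (i↝j , refl) ◅ (k↝j , refl) ◅ ε)
    where
      2+j≡J : suc (suc j) ≡ J
      2+j≡J = trans (sym (+-identityʳ (suc (suc j)))) (trans s (trans (sym t) (+-identityʳ J)))
  from-near-cornerⱼ 3≤r {suc j} {zero} {J} {suc zero} s _ t =
    2 , ≤-trans (n≤1+n 2) 3≤r , subst (λ x → Path evenRule 2 (1 , suc j , 0) (0 , x , 1)) 1+j≡J
                                      ((j↝k , refl) ◅ (i↝j , refl) ◅ ε)
    where
      1+j≡J : suc j ≡ J
      1+j≡J = +-cancelʳ-≡ 1 _ _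
        (trans (+-comm (suc j) 1) (trans (sym (+-identityʳ (suc (suc j)))) (trans s (sym t))))
  from-near-cornerⱼ _ {suc j} {zero} {k = suc (suc _)} _ (s≤s ()) _

  via-row₁-from-cornerᵢ : ∀ {I v} → I < r → (e : Row₁Exit I v) → Row₁Exit.excess e ≤ I →
                         Reach evenRule r (r , 0 , 0) v
  via-row₁-from-cornerᵢ {I} I<r e e₁≤I =
    via-row₁ entry e (split-bound {c = r} (Row₁Entry.excess-bound entry) e₁≤I)
    where
      entry : Row₁Entry r I (r , 0 , 0)
      entry = enter₁-from₀ (i+0+0≡i r) I<r

  from-cornerᵢ : ∀ {I J k} → k ≤ 1 → I + J + k ≡ r → (k ≡ 0 → 2 ≤ I) →
                Reach evenRule r (r , 0 , 0) (I , J , k)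
  from-cornerᵢ {I} {J} {k} k≤1 t k≡0⇒2≤I with I ≟ r
  ... | yes refl = 0 , z≤n , subst₂ (λ x y → Path evenRule 0 (I , 0 , 0) (I , x , y)) (sym J≡0) (sym k≡0) ε
    where
      J+k≡0 : J + k ≡ 0
      J+k≡0 = +-cancelˡ-≡ I _ _ (trans (sym (+-assoc I J k)) (trans t (sym (+-identityʳ I))))
      J≡0 : J ≡ 0
      J≡0 = m+n≡0⇒m≡0 J J+k≡0
      k≡0 : k ≡ 0
      k≡0 = m+n≡0⇒n≡0 J J+k≡0
  from-cornerᵢ {I} {J} {0} _ t 2≤I | no I≢r =
    via-row₁-from-cornerᵢ I<r exit (≤-trans (Row₁Exit.excess≤2 exit) (2≤I refl))
    where
      I<r : I < r
      I<r = ≤∧≢⇒< (coord≤total t) I≢r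
      exit : Row₁Exit I (I , J , 0)
      exit = exit₁-to₀ t I<r
  from-cornerᵢ {k = 1} _ t _ | no I≢r =
    via-row₁-from-cornerᵢ (≤∧≢⇒< (coord≤total t) I≢r) (exit₁-to₁ t) z≤n
  from-cornerᵢ {k = suc (suc _)} (s≤s ()) _ _ | no _

-- Climbing two levels

Diameter : Rule → ℕ → Set
Diameter R n = ∀ a b → total a ≡ n → total b ≡ n → Reach R (suc n) a b

record EvenLevel (m : ℕ) : Set where
  field
    diameter          : Diameter evenRule (suc m)
    from-cornerᵢ      : ∀ b → total b ≡ suc m → b ≢ (0 , suc m , 0) → b ≢ (1 , m , 0) →
                        Reach evenRule (suc m) (suc m , 0 , 0) b
    from-near-cornerⱼ : ∀ b → total b ≡ suc m → Reach evenRule (suc m) (1 , m , 0) b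

  to-cornerⱼ : ∀ a → total a ≡ suc m → a ≢ (suc m , 0 , 0) → a ≢ (m , 1 , 0) →
               Reach evenRule (suc m) a (0 , suc m , 0)
  to-cornerⱼ a s a≢c a≢c′ =
    swap-reach (from-cornerᵢ (swap a) (trans (total-swap a) s) (a≢c ∘ cong swap) (a≢c′ ∘ cong swap))

lift₁-total : ∀ i j k {n} → i + j + suc k ≡ suc n → i + j + k ≡ n
lift₁-total i j k s = suc-injective (trans (sym (+-suc (i + j) k)) s)

lift₂-total : ∀ i j k {n} → i + j + suc (suc k) ≡ suc (suc n) → i + j + k ≡ n
lift₂-total i j k s = lift₁-total i j k (lift₁-total i j (suc k) s)

2≤first : ∀ {I J n} → I + J + 0 ≡ suc n → (I , J , 0) ≢ (0 , suc n , 0) → (I , J , 0) ≢ (1 , n , 0) →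
          2 ≤ I
2≤first {zero}        s ≢c _   = ⊥-elim (≢c (cong (λ x → 0 , x , 0) (trans (sym (+-identityʳ _)) s)))
2≤first {suc zero}    s _  ≢c′ =
  ⊥-elim (≢c′ (cong (λ x → 1 , x , 0) (suc-injective (trans (sym (+-identityʳ _)) s))))
2≤first {suc (suc I)} _ _  _   = s≤s (s≤s z≤n)

module EvenStep (m : ℕ) (level-even : odd (suc m) ≡ false) (3≤m : 3 ≤ m) (below : EvenLevel m) where

  r : ℕ
  r = 3 + m

  open EvenLevel below

  lift₂-reach : ∀ {n a b} → Reach evenRule n a b → Reach evenRule n (lift₂ a) (lift₂ b)
  lift₂-reach = map-reach lift₂ lift₂-step

  module B = Band {r} level-even
  open B hiding (from-near-cornerⱼ; from-cornerᵢ)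

  odd-m : odd m ≡ true
  odd-m = trans (sym (not-odd-suc m)) (cong not level-even)

  data Climb (a : Triple) : Set where
    short : ∀ c s → c ≤ 2 → total s ≡ suc m → Path evenRule c a (lift₂ s) → Climb a
    via-near-cornerⱼ : Path evenRule 3 a (lift₂ (1 , m , 0)) → Climb a

  climb : ∀ i j k → k ≤ 1 → i + j + k ≡ r → Climb (i , j , k)
  climb zero j zero _ s rewrite +-identityʳ j | s =
    via-near-cornerⱼ ((j↝i , refl) ◅ (j↝k , refl) ◅ (j↝k , refl) ◅ ε)
  climb zero j (suc zero) _ s rewrite suc-injective (trans (+-comm 1 j) s) =
    via-near-cornerⱼ ((k↝i , odd-m) ◅ (j↝k , refl) ◅ (j↝k , refl) ◅ ε)
  climb (suc i) j zero _ s with odd (suc i) in oi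
  climb (suc i) zero zero _ s | true with trans (row₀-parity (suc i) 0 s) oi
  ... | ()
  climb (suc i) (suc j) zero _ s | true =
    short 2 (i , j , 0) (s≤s (s≤s z≤n)) (lift₂-total i j 0 (trans (shift i j) s))
          ((j↝k , oi) ◅ (i↝k , trans (sym (odd-suc j)) (trans (row₀-parity (suc i) (suc j) s) oi)) ◅ ε)
    where
      shift : ∀ i j → i + j + 2 ≡ suc i + suc j + 0
      shift = solve-∀
  climb (suc zero) j zero _ s | false with oi
  ... | ()
  climb (suc (suc i)) j zero _ s | false =
    short 2 (i , j , 0) (s≤s (s≤s z≤n)) (lift₂-total i j 0 (trans (shift i j) s))
          ((i↝k , cong not even-j) ◅ (i↝k , cong not even-j) ◅ ε)
    where
      even-j : odd j ≡ false
      even-j = trans (row₀-parity (suc (suc i)) j s) oi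
      shift : ∀ i j → i + j + 2 ≡ suc (suc i) + j + 0
      shift = solve-∀
  climb (suc i) j (suc zero) _ s with odd (suc i) in oi
  ... | true =
    short 1 (i , j , 0) (s≤s z≤n) (lift₂-total i j 0 (trans (shift i j) s))
          ((i↝k , cong not (trans (row₁-parity (suc i) j s) (cong not oi))) ◅ ε)
    where
      shift : ∀ i j → i + j + 2 ≡ suc i + j + 1
      shift = solve-∀
  climb (suc zero) j (suc zero) _ s | false with oi
  ... | ()
  climb (suc (suc i)) j (suc zero) _ s | false =
    short 2 (i , suc j , 0) (s≤s (s≤s z≤n)) (lift₂-total i (suc j) 0 (trans (shift i j) s))
          ((i↝j , refl) ◅ (i↝k , trans (not-odd-suc j) odd-j) ◅ ε)
    where
      odd-j : odd j ≡ true
      odd-j = trans (row₁-parity (suc (suc i)) j s) (cong not oi)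
      shift : ∀ i j → i + suc j + 2 ≡ suc (suc i) + j + 1
      shift = solve-∀
  climb i j (suc (suc k)) (s≤s ()) s

  band-to-lifted : ∀ i j k → k ≤ 1 → i + j + k ≡ r → ∀ b → total b ≡ suc m →
                   Reach evenRule (suc r) (i , j , k) (lift₂ b)
  band-to-lifted i j k k≤1 s b t with climb i j k k≤1 s
  ... | short c a c≤2 a-total p =
    reach-mono (+-monoˡ-≤ (2 + m) c≤2)
      (path⇒reach p ◅◅ʳ lift₂-reach (diameter a b a-total t))
  ... | via-near-cornerⱼ p = path⇒reach p ◅◅ʳ lift₂-reach (from-near-cornerⱼ b t)

  lifted-to-band : ∀ a → total a ≡ suc m → ∀ I J K → K ≤ 1 → I + J + K ≡ r →
                   Reach evenRule (suc r) (lift₂ a) (I , J , K)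
  lifted-to-band a s I J K K≤1 t =
    swap-reach (band-to-lifted J I K K≤1 (trans (total-swap (I , J , K)) t) (swap a) (trans (total-swap a) s))

  diameter′ : Diameter evenRule r
  diameter′ (i , j , suc (suc k)) (I , J , suc (suc K)) s t =
    reach-mono (m≤n+m (2 + m) 2)
      (lift₂-reach (diameter (i , j , k) (I , J , K) (lift₂-total i j k s) (lift₂-total I J K t)))
  diameter′ (i , j , 0) (I , J , suc (suc K)) s t = band-to-lifted i j 0 z≤n s (I , J , K) (lift₂-total I J K t)
  diameter′ (i , j , 1) (I , J , suc (suc K)) s t =
    band-to-lifted i j 1 (s≤s z≤n) s (I , J , K) (lift₂-total I J K t)
  diameter′ (i , j , suc (suc k)) (I , J , 0) s t = lifted-to-band (i , j , k) (lift₂-total i j k s) I J 0 z≤n t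
  diameter′ (i , j , suc (suc k)) (I , J , 1) s t =
    lifted-to-band (i , j , k) (lift₂-total i j k s) I J 1 (s≤s z≤n) t
  diameter′ (i , j , 0) (I , J , 0) s t = band₀₀ s t
  diameter′ (i , j , 0) (I , J , 1) s t = band₀₁ s t
  diameter′ (i , j , 1) (I , J , 0) s t = band₁₀ s t
  diameter′ (i , j , 1) (I , J , 1) s t = band₁₁ (+-monoʳ-≤ 3 (≤-trans (s≤s z≤n) 3≤m)) s t

  from-near-cornerⱼ′ : ∀ b → total b ≡ r → Reach evenRule r (1 , 2 + m , 0) b
  from-near-cornerⱼ′ (I , J , suc (suc K)) t =
    path⇒reach ((j↝k , refl) ◅ (j↝k , refl) ◅ ε)
      ◅◅ʳ lift₂-reach (from-near-cornerⱼ (I , J , K) (lift₂-total I J K t))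
  from-near-cornerⱼ′ (I , J , 0) t = B.from-near-cornerⱼ (m≤m+n 3 m) (+-identityʳ r) z≤n t
  from-near-cornerⱼ′ (I , J , 1) t = B.from-near-cornerⱼ (m≤m+n 3 m) (+-identityʳ r) (s≤s z≤n) t

  down-to-row₁ : Path evenRule (2 + m) (r , 0 , 0) (1 , suc m , 1)
  down-to-row₁ = (i↝k , refl) ◅ row-i↝j 1 (λ _ _ → refl) (s≤s z≤n) (+-identityʳ (2 + m))

  from-cornerᵢ′ : ∀ b → total b ≡ r → b ≢ (0 , r , 0) → b ≢ (1 , 2 + m , 0) →
                  Reach evenRule r (r , 0 , 0) b
  from-cornerᵢ′ (I , J , 0) t ≢c ≢c′ = B.from-cornerᵢ z≤n t (λ _ → 2≤first t ≢c ≢c′)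
  from-cornerᵢ′ (I , J , 1) t _ _   = B.from-cornerᵢ (s≤s z≤n) t (λ ())
  from-cornerᵢ′ (I , J , suc (suc K)) t _ _ with (I , J , K) ≟ᵗ (0 , suc m , 0) | (I , J , K) ≟ᵗ (1 , m , 0)
  ... | yes refl | _        = path⇒reach (down-to-row₁ ▻ (i↝k , cong not level-even))
  ... | no _     | yes refl = path⇒reach (down-to-row₁ ▻ (j↝k , refl))
  ... | no ≢c    | no ≢c′   =
    path⇒reach ((i↝k , refl) ◅ (i↝k , refl) ◅ ε)
      ◅◅ʳ lift₂-reach (from-cornerᵢ (I , J , K) (lift₂-total I J K t) ≢c ≢c′)

  above : EvenLevel (2 + m)
  above = record
    { diameter = diameter′ ; from-cornerᵢ = from-cornerᵢ′ ; from-near-cornerⱼ = from-near-cornerⱼ′ }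

-- Odd levels

module OddLevel (m : ℕ) (below : EvenLevel m) where

  r : ℕ
  r = 2 + m

  open EvenLevel below

  lift₁-reach : ∀ {n a b} → Reach evenRule n a b → Reach oddRule n (lift₁ a) (lift₁ b)
  lift₁-reach = map-reach lift₁ lift₁-step

  row₀-to-row₁-total : ∀ i j → i + suc j + 0 ≡ r → i + j + 0 ≡ suc m
  row₀-to-row₁-total i j s = lift₁-total i j 0 (trans (shift i j) s)
    where
      shift : ∀ i j → i + j + 1 ≡ i + suc j + 0
      shift = solve-∀

  along-row₀ : Path oddRule r (r , 0 , 0) (0 , r , 0)
  along-row₀ = row-i↝j 0 (λ _ _ → refl) z≤n (+-identityʳ r)

  along-row₀-to-near-cornerⱼ : Path oddRule (suc m) (r , 0 , 0) (1 , suc m , 0)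
  along-row₀-to-near-cornerⱼ = row-i↝j 0 (λ _ _ → refl) (s≤s z≤n) (+-identityʳ r)

  along-row₀-from-near-cornerⱼ : Path oddRule (suc m) (suc m , 1 , 0) (0 , r , 0)
  along-row₀-from-near-cornerⱼ = row-i↝j 0 (λ _ _ → refl) z≤n (+-comm (suc m) 1)

  cornerᵢ-to-lifted : ∀ b → total b ≡ suc m → Reach oddRule (suc r) (r , 0 , 0) (lift₁ b)
  cornerᵢ-to-lifted b t with b ≟ᵗ (0 , suc m , 0) | b ≟ᵗ (1 , m , 0)
  ... | yes refl | _        = path⇒reach (along-row₀ ▻ (j↝k , refl))
  ... | no _     | yes refl = reach-mono (n≤1+n r) (path⇒reach (along-row₀-to-near-cornerⱼ ▻ (j↝k , refl)))
  ... | no ≢c    | no ≢c′   =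
    path⇒reach ((i↝j , refl) ◅ (j↝k , refl) ◅ ε) ◅◅ʳ lift₁-reach (from-cornerᵢ b t ≢c ≢c′)

  lifted-to-cornerⱼ : ∀ a → total a ≡ suc m → Reach oddRule (suc r) (lift₁ a) (0 , r , 0)
  lifted-to-cornerⱼ a s with a ≟ᵗ (suc m , 0 , 0) | a ≟ᵗ (m , 1 , 0)
  ... | yes refl | _        = path⇒reach ((k↝i , refl) ◅ along-row₀)
  ... | no _     | yes refl =
    reach-mono (n≤1+n r) (path⇒reach ((k↝i , refl) ◅ along-row₀-from-near-cornerⱼ))
  ... | no ≢c    | no ≢c′   = reach-mono (≤-reflexive (+-comm (suc m) 2))
    (lift₁-reach (to-cornerⱼ a s ≢c ≢c′) ◅◅ʳ path⇒reach ((k↝i , refl) ◅ (i↝j , refl) ◅ ε))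

  within-row₀ : ∀ {i j I J} → i + j + 0 ≡ r → I + J + 0 ≡ r →
                Reach oddRule (suc r) (i , j , 0) (I , J , 0)
  within-row₀ {i} {j} {I} {J} s t with I ≤? i
  ... | yes I≤i = i ∸ I , ≤-trans (m∸n≤m i I) (≤-trans (coord≤total s) (n≤1+n r)) ,
                  row-i↝j 0 (λ _ _ → refl) I≤i (+-cancelʳ-≡ 0 _ _ (trans s (sym t)))
  within-row₀ {I = zero} _ _ | no I≰i = ⊥-elim (I≰i z≤n)
  within-row₀ {i} {zero} s t | no I≰i =
    ⊥-elim (I≰i (≤-trans (coord≤total t) (≤-reflexive (trans (sym s) (i+0+0≡i i)))))
  within-row₀ {i} {suc j} {suc I} {J} s t | no I≰i =
    suc (suc (I ∸ i)) , s≤s (≤-trans (s≤s (m∸n≤m I i)) (coord≤total t)) ,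
    (j↝k , refl) ◅ (row-j↝i 1 (λ _ _ → refl) i≤I same ▻ (k↝i , refl))
    where
      i≤I : i ≤ I
      i≤I = ≤-pred (≰⇒> I≰i)
      same : i + j ≡ I + J
      same = suc-injective (trans (sym (+-suc i j)) (+-cancelʳ-≡ 0 _ _ (trans s (sym t))))

  diameter-odd : Diameter oddRule r
  diameter-odd (i , j , suc k) (I , J , suc K) s t =
    reach-mono (n≤1+n r)
      (lift₁-reach (diameter (i , j , k) (I , J , K) (lift₁-total i j k s) (lift₁-total I J K t)))
  diameter-odd (i , suc j , 0) (I , J , suc K) s t =
    path⇒reach ((j↝k , refl) ◅ ε)
      ◅◅ʳ lift₁-reach (diameter (i , j , 0) (I , J , K) (row₀-to-row₁-total i j s) (lift₁-total I J K t))
  diameter-odd (i , 0 , 0) (I , J , suc K) s t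
    rewrite trans (sym (i+0+0≡i i)) s = cornerᵢ-to-lifted (I , J , K) (lift₁-total I J K t)
  diameter-odd (i , j , suc k) (suc I , J , 0) s t =
    reach-mono (≤-reflexive (+-comm r 1))
      (lift₁-reach (diameter (i , j , k) (I , J , 0) (lift₁-total i j k s)
                                                     (lift₁-total I J 0 (trans (shift I J) t)))
        ◅◅ʳ path⇒reach ((k↝i , refl) ◅ ε))
    where
      shift : ∀ I J → I + J + 1 ≡ suc I + J + 0
      shift = solve-∀
  diameter-odd (i , j , suc k) (0 , J , 0) s t
    rewrite trans (sym (+-identityʳ J)) t = lifted-to-cornerⱼ (i , j , k) (lift₁-total i j k s)
  diameter-odd (i , j , 0) (I , J , 0) s t = within-row₀ s t

-- Small levels, by exhaustive search

suc-i suc-j : Triple → Triple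
suc-i (i , j , k) = suc i , j , k
suc-j (i , j , k) = i , suc j , k

column : ℕ → List Triple
column zero    = (0 , 0 , 0) ∷ []
column (suc n) = (0 , 0 , suc n) ∷ map suc-j (column n)

triples : ℕ → List Triple
triples zero    = column zero
triples (suc n) = column (suc n) ++ map suc-i (triples n)

∈-column : ∀ j k → (0 , j , k) ∈ column (j + k)
∈-column zero    zero    = here refl
∈-column zero    (suc k) = here refl
∈-column (suc j) k       = there (∈-map⁺ suc-j (∈-column j k))

column⊆triples : ∀ n {a} → a ∈ column n → a ∈ triples n
column⊆triples zero    a∈ = a∈
column⊆triples (suc n) a∈ = ∈-++⁺ˡ a∈

∈-triples : ∀ a {n} → total a ≡ n → a ∈ triples n
∈-triples (zero  , j , k) refl = column⊆triples (j + k) (∈-column j k)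
∈-triples (suc i , j , k) refl =
  ∈-++⁺ʳ (column (suc (i + j + k))) (∈-map⁺ suc-i (∈-triples (i , j , k) refl))

moves : ∀ a → List (∃ (Move a))
moves (i , j , k) = from-i i j k ++ from-j i j k ++ from-k i j k
  where
    from-i from-j from-k : ∀ i j k → List (∃ (Move (i , j , k)))
    from-i zero    j k = []
    from-i (suc i) j k = (_ , i↝j) ∷ (_ , i↝k) ∷ []
    from-j i zero    k = []
    from-j i (suc j) k = (_ , j↝i) ∷ (_ , j↝k) ∷ []
    from-k i j zero    = []
    from-k i j (suc k) = (_ , k↝i) ∷ (_ , k↝j) ∷ []

steps : ∀ R a → List (∃ (Step R a))
steps R a = mapMaybe allowed (moves a)
  where
    allowed : ∃ (Move a) → Maybe (∃ (Step R a))
    allowed (b , m) with permits R m in e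
    ... | true  = just (b , m , e)
    ... | false = nothing

reach? : ∀ R n a b → Maybe (Reach R n a b)
reach? R n a b with a ≟ᵗ b
... | yes refl = just (0 , z≤n , ε)
reach? R zero    a b | no _ = nothing
reach? R (suc n) a b | no _ = foldr _<∣>_ nothing (map extend (steps R a))
  where
    extend : ∃ (Step R a) → Maybe (Reach R (suc n) a b)
    extend (c , s) = Maybe.map (path⇒reach (s ◅ ε) ◅◅ʳ_) (reach? R n c b)

on-level? : ∀ {P : Triple → Set} n → (∀ a → Maybe (P a)) → Maybe (∀ a → total a ≡ n → P a)
on-level? n f = Maybe.map (λ all a s → All.lookup all (∈-triples a s))
                          (All.sequenceA _ applicative (All.universal f (triples n)))

unless? : ∀ {P : Triple → Set} (c c′ : Triple) → (∀ b → Maybe (P b)) →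
          ∀ b → Maybe (b ≢ c → b ≢ c′ → P b)
unless? c c′ f b with b ≟ᵗ c | b ≟ᵗ c′
... | yes b≡c | _        = just (λ b≢c _ → ⊥-elim (b≢c b≡c))
... | no _    | yes b≡c′ = just (λ _ b≢c′ → ⊥-elim (b≢c′ b≡c′))
... | no _    | no _     = Maybe.map (λ p _ _ → p) (f b)

diameter-3 : Diameter oddRule 3
diameter-3 a b s t = table a s b t
  where
    table : ∀ a → total a ≡ 3 → ∀ b → total b ≡ 3 → Reach oddRule 4 a b
    table = from-just (on-level? 3 λ a → on-level? 3 λ b → reach? oddRule 4 a b)

level-4 : EvenLevel 3
level-4 = record
  { diameter          = λ a b s t → diameters a s b t
  ; from-cornerᵢ      = from-just (on-level? 4 (unless? (0 , 4 , 0) (1 , 3 , 0) (reach? evenRule 4 (4 , 0 , 0))))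
  ; from-near-cornerⱼ = from-just (on-level? 4 (reach? evenRule 4 (1 , 3 , 0)))
  }
  where
    diameters : ∀ a → total a ≡ 4 → ∀ b → total b ≡ 4 → Reach evenRule 5 a b
    diameters = from-just (on-level? 4 λ a → on-level? 4 λ b → reach? evenRule 5 a b)

-- The upper bound

even-level : ∀ m → odd (suc m) ≡ false → 3 ≤ m → EvenLevel m
even-level 3 _ _ = level-4
even-level (suc (suc (suc (suc (suc m))))) e _ =
  EvenStep.above (3 + m) e (m≤m+n 3 m) (even-level (suc (suc (suc m))) e (m≤m+n 3 m))
even-level 1 _ (s≤s ())

odd⇒1≤ : ∀ {m} → odd m ≡ true → 1 ≤ m
odd⇒1≤ {suc m} _ = s≤s z≤n

diameter-at : ∀ r → 3 ≤ r → ∃ λ R → Diameter R r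
diameter-at 3 _ = oddRule , diameter-3
diameter-at 1 (s≤s ())
diameter-at 2 (s≤s (s≤s ()))
diameter-at (suc (suc (suc (suc m)))) _ with odd m in e
... | false = evenRule , EvenLevel.diameter (even-level (3 + m) e (m≤m+n 3 m))
... | true  = oddRule , OddLevel.diameter-odd (2 + m)
                (even-level (2 + m) (trans (odd-suc m) (cong not e)) (+-monoʳ-≤ 2 (odd⇒1≤ e)))

realise : ∀ R r → Diameter R r → Σ (Orientation r) λ o → StronglyConnected o × DiameterAtMost o (r + 1)
realise R r diam = orientation R r , (λ u v → r + 1 , within u v) , within
  where
    within : DiameterAtMost (orientation R r) (r + 1)
    within (a , p) (b , q) = reach⇒reachWithin (reach-mono (≤-reflexive (+-comm 1 r)) (diam a b p q)) p q

-- The lower bound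

second third : Triple → ℕ
second (i , j , k) = j
third  (i , j , k) = k

move-second : ∀ {a b} → Move a b → second b ≤ suc (second a)
move-second (i↝j {j = j}) = ≤-refl
move-second (j↝i {j = j}) = m≤n⇒m≤1+n (n≤1+n j)
move-second (j↝k {j = j}) = m≤n⇒m≤1+n (n≤1+n j)
move-second (k↝j {j = j}) = ≤-refl
move-second (k↝i {j = j}) = n≤1+n j
move-second (i↝k {j = j}) = n≤1+n j

move-third : ∀ {a b} → Move a b → third b ≤ suc (third a)
move-third (i↝j {k = k}) = n≤1+n k
move-third (j↝i {k = k}) = n≤1+n k
move-third (j↝k {k = k}) = ≤-refl
move-third (k↝j {k = k}) = m≤n⇒m≤1+n (n≤1+n k)
move-third (k↝i {k = k}) = m≤n⇒m≤1+n (n≤1+n k)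
move-third (i↝k {k = k}) = ≤-refl

walk-bound : ∀ (f : Triple → ℕ) → (∀ {a b} → Move a b → f b ≤ suc (f a)) →
             ∀ {r} {o : Orientation r} {n u v} → Walk o n u v → f (proj₁ v) ≤ n + f (proj₁ u)
walk-bound f bound here = ≤-refl
walk-bound f bound {n = suc n} {u} {v} (step {v = w} (adj , _) rest) = begin
  f (proj₁ v)           ≤⟨ walk-bound f bound rest ⟩
  n + f (proj₁ w)       ≤⟨ +-monoʳ-≤ n (bound (adj⇒move u w adj)) ⟩
  n + suc (f (proj₁ u)) ≡⟨ +-suc n _ ⟩
  suc n + f (proj₁ u)   ∎
  where open ≤-Reasoning

vertex-≡ : ∀ {r} {u v : Vertex r} → proj₁ u ≡ proj₁ v → u ≡ v
vertex-≡ {u = t , p} {.t , q} refl = cong (t ,_) (≡-irrelevant p q)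

module Corner {r₁ : ℕ} (o : Orientation (suc r₁)) where

  r : ℕ
  r = suc r₁

  corner to-j to-k far-j far-k : Vertex r
  corner = (r , 0 , 0) , cong suc (i+0+0≡i r₁)
  to-j   = (r₁ , 1 , 0) , trans (+-identityʳ (r₁ + 1)) (+-comm r₁ 1)
  to-k   = (r₁ , 0 , 1) , trans (cong (_+ 1) (+-identityʳ r₁)) (+-comm r₁ 1)
  far-j  = (0 , r , 0) , +-identityʳ r
  far-k  = (0 , 0 , r) , refl

  from-corner : ∀ y → Adj r corner y → y ≡ to-j ⊎ y ≡ to-k
  from-corner y adj with adj⇒move corner y adj
  ... | i↝j = inj₁ (vertex-≡ refl)
  ... | i↝k = inj₂ (vertex-≡ refl)

  into-corner : ∀ y → Adj r y corner → y ≡ to-j ⊎ y ≡ to-k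
  into-corner y adj with adj⇒move y corner adj
  ... | j↝i = inj₁ (vertex-≡ refl)
  ... | k↝i = inj₂ (vertex-≡ refl)

  far-k-distance : ∀ {n} → dir o corner to-k ≡ false → Walk o n corner far-k → suc r ≤ n
  far-k-distance ¬ck (step {v = y} (adj , d) rest) with from-corner y adj
  ... | inj₁ refl = s≤s (≤-trans (walk-bound third move-third rest) (≤-reflexive (+-identityʳ _)))
  ... | inj₂ refl with trans (sym d) ¬ck
  ...   | ()

  far-j-distance : ∀ {n} → dir o corner to-j ≡ false → Walk o n corner far-j → suc r ≤ n
  far-j-distance ¬cj (step {v = y} (adj , d) rest) with from-corner y adj
  ... | inj₂ refl = s≤s (≤-trans (walk-bound second move-second rest) (≤-reflexive (+-identityʳ _)))
  ... | inj₁ refl with trans (sym d) ¬cj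
  ...   | ()

  source : dir o corner to-j ≡ true → dir o corner to-k ≡ true →
           ∀ {n u} → Walk o n u corner → proj₁ u ≡ proj₁ corner
  source cj ck here = refl
  source cj ck {u = u} (step {v = w} (adj , d) rest) with vertex-≡ {u = w} {corner} (source cj ck rest)
  ... | refl with into-corner u adj
  ...   | inj₁ refl with trans (sym d) (trans (antisym o to-j corner adj) (cong not cj))
  ...     | ()
  source cj ck {u = u} (step (adj , d) rest) | refl | inj₂ refl
    with trans (sym d) (trans (antisym o to-k corner adj) (cong not ck))
  ... | ()

  diameter≥ : ∀ d → DiameterAtMost o d → suc r ≤ d
  diameter≥ d within with dir o corner to-k in ck | dir o corner to-j in cj
  ... | false | _    = let n , n≤d , w = within corner far-k in ≤-trans (far-k-distance ck w) n≤d
  ... | true | false = let n , n≤d , w = within corner far-j in ≤-trans (far-j-distance cj w) n≤d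
  ... | true | true  with source cj ck (proj₂ (proj₂ (within to-j corner)))
  ...   | ()

theorem1 : (r : ℕ) → 2 < r → OrientedDiameterIs r (r + 1)
theorem1 (suc r₁) 2<r =
  let R , diam = diameter-at (suc r₁) 2<r in
  realise R (suc r₁) diam ,
  λ o _ d within → ≤-trans (≤-reflexive (+-comm (suc r₁) 1)) (Corner.diameter≥ o d within)
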